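{- Let $n\ge1$. The map sending a one-row descending plane partition $a=(a_1,\dots,a_m)$ of order $n$ with no special part to the permutation $\beta\gamma$ of $\{1,\dots,n\}$, where $\gamma=(a_1,a_2-1,\dots,a_m-(m-1))$ and $\beta$ is $\{1,\dots,n\}\setminus\{\gamma_1,\dots,\gamma_m\}$ written in decreasing order, is a bijection onto the set of permutations of $\{1,\dots,n\}$ with exactly one ascent.
   Context: A one-row descending plane partition of order $n$ is a sequence $(a_1,\dots,a_m)$, $m\ge1$, of positive integers with $n\ge a_1\ge a_2\ge\dots\ge a_m$ and $a_1>m$. It has no special part if $a_j> j-1$ for all $j$, i.e. $a_j\ge j$ for $1\le j\le m$. A permutation $\pi$ of $\{1,\dots,n\}$ has an ascent at position $k$ ($1\le k<n$) if $\pi_k<\pi_{k+1}$; $\beta\gamma$ denotes concatenation. -}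

module Defs where

open import Data.Nat using (ℕ; zero; suc; _+_; _∸_; _≤_; _<_; _>_; _≟_; _<ᵇ_)
open import Data.Bool using (if_then_else_)
open import Data.List using (List; []; _∷_; length; map; upTo; downFrom; filter; zipWith; _++_; lookup)
open import Data.List.Relation.Unary.All using (All)
open import Data.List.Relation.Unary.Linked using (Linked)
open import Data.List.Relation.Binary.Permutation.Propositional using (_↭_)
open import Data.List.Membership.DecPropositional _≟_ using (_∈?_)
open import Data.Fin using (Fin; toℕ)
open import Data.Product using (_×_)
open import Relation.Nullary using (¬?)
open import Relation.Binary.PropositionalEquality using (_≡_)

oneTo : ℕ → List ℕ
oneTo n = map suc (upTo n)

decreasingOneTo : ℕ → List ℕ
decreasingOneTo n = map suc (downFrom n)

data IsOneRowDPP (n : ℕ) : List ℕ → Set where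
  dpp : ∀ {a₁ as} →
        All (1 ≤_) (a₁ ∷ as) →
        a₁ ≤ n →
        Linked (λ x y → y ≤ x) (a₁ ∷ as) →
        a₁ > length (a₁ ∷ as) →
        IsOneRowDPP n (a₁ ∷ as)

-- no special part: a_j ≥ j for 1 ≤ j ≤ m (positions are 0-based Fin indices i, j = i+1)
NoSpecialPart : List ℕ → Set
NoSpecialPart a = (i : Fin (length a)) → suc (toℕ i) ≤ lookup a i

gamma : List ℕ → List ℕ
gamma a = zipWith _∸_ a (upTo (length a))

beta : ℕ → List ℕ → List ℕ
beta n a = filter (λ x → ¬? (x ∈? gamma a)) (decreasingOneTo n)

dppToPerm : ℕ → List ℕ → List ℕ
dppToPerm n a = beta n a ++ gamma a

IsPermutation : ℕ → List ℕ → Set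
IsPermutation n π = π ↭ oneTo n

ascents : List ℕ → ℕ
ascents [] = 0
ascents (x ∷ []) = 0
ascents (x ∷ y ∷ xs) = (if x <ᵇ y then 1 else 0) + ascents (y ∷ xs)

OneRowDPPNoSpecial : ℕ → List ℕ → Set
OneRowDPPNoSpecial n a = IsOneRowDPP n a × NoSpecialPart a

PermOneAscent : ℕ → List ℕ → Set
PermOneAscent n π = IsPermutation n π × ascents π ≡ 1

-- No special part and a_j ≥ a_{j+1} say exactly that γ
-- is a strictly decreasing sequence of positive integers, and a ↦ γ is undone
-- by adding the positions back. A strictly decreasing γ of length m has all
-- its values in [1, γ_1], so a_1 = γ_1 > m says that some value below γ_1 is
-- missing from γ, i.e. the decreasing complement β has an element below γ_1:
-- βγ is then two decreasing runs with a single ascent at the junction.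
-- Conversely a permutation with one ascent splits there into two decreasing
-- runs βγ, β is forced to be the complement of γ, and the ascent gives the
-- missing value that makes γ come from some a.
module Submission where

open import Defs
open import Data.Nat using (ℕ; zero; suc; _+_; _∸_; _≤_; _<_; _≥_; _>_; _≟_; _<?_; _<ᵇ_; z≤n; s≤s)
open import Data.Nat.Properties
open import Data.Bool using (true; false; if_then_else_)
open import Data.List using (List; []; _∷_; length; upTo; applyUpTo; filter; zipWith; _++_; lookup)
open import Data.List.Properties using (reverse-upTo; partition-defn)
open import Data.List.Relation.Unary.All as All using (All; []; _∷_)
open import Data.List.Relation.Unary.All.Properties using (++⁻ˡ; ++⁻ʳ)
open import Data.List.Relation.Unary.Any using (Any; here; there)
open import Data.List.Relation.Unary.Linked as Linked using (Linked; []; [-]; _∷_)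
import Data.List.Relation.Unary.Linked.Properties as Linkedₚ
open import Data.List.Relation.Unary.Unique.Propositional using (Unique; []; _∷_)
open import Data.List.Relation.Unary.Unique.Propositional.Properties as Unique using (downFrom⁺)
open import Data.List.Relation.Binary.Permutation.Propositional using (_↭_; ↭-trans; ↭-sym; ↭-reflexive; ↭⇒↭ₛ; ↭ₛ⇒↭)
open import Data.List.Relation.Binary.Permutation.Propositional.Properties using (↭-reverse; map⁺; ∈-resp-↭)
import Data.List.Relation.Binary.Permutation.Setoid.Properties as PermutationₛProperties
open import Data.List.Membership.Propositional using (_∈_; _∉_; lose; find)
open import Data.List.Membership.Propositional.Properties using (∈-map⁺; ∈-map⁻; ∈-downFrom⁺; ∈-downFrom⁻; ∈-filter⁺; ∈-filter⁻; ∈-++⁺ˡ; ∈-++⁺ʳ; ∈-++⁻)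
open import Data.List.Membership.DecPropositional _≟_ using (_∈?_)
open import Data.Fin using (Fin; toℕ) renaming (zero to fzero; suc to fsuc)
open import Data.Product using (_×_; Σ; _,_; proj₁; proj₂)
open import Data.Sum using (_⊎_; inj₁; inj₂)
open import Data.Unit using (⊤; tt)
open import Data.Empty using (⊥-elim)
open import Function using (_∘_; flip)
open import Relation.Nullary using (¬_; ¬?; Dec; yes; no)
open import Relation.Nullary.Decidable using (decidable-stable)
open import Relation.Nullary.Reflects using (ofʸ; ofⁿ)
open import Relation.Binary.PropositionalEquality

private
  variable
    k n g x y z : ℕ
    xs ys gs β γ δ π : List ℕ

Linked>⇒All<head : Linked _>_ (x ∷ xs) → All (_< x) xs
Linked>⇒All<head [-] = []
Linked>⇒All<head (x>y ∷ l) = Linkedₚ.Linked⇒All (flip <-trans) x>y l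

∈⇒≤head : Linked _>_ (x ∷ xs) → y ∈ x ∷ xs → y ≤ x
∈⇒≤head l (here refl) = ≤-refl
∈⇒≤head l (there y∈xs) = <⇒≤ (All.lookup (Linked>⇒All<head l) y∈xs)

decreasing-ext : Linked _>_ xs → Linked _>_ ys →
                 (∀ {z} → z ∈ xs → z ∈ ys) → (∀ {z} → z ∈ ys → z ∈ xs) → xs ≡ ys
decreasing-ext {[]} {[]} _ _ _ _ = refl
decreasing-ext {[]} {y ∷ ys} _ _ _ ys⊆xs with () ← ys⊆xs (here refl)
decreasing-ext {x ∷ xs} {[]} _ _ xs⊆ys _ with () ← xs⊆ys (here refl)
decreasing-ext {x ∷ xs} {y ∷ ys} lx ly xs⊆ys ys⊆xs =
  cong₂ _∷_ x≡y (decreasing-ext (Linked.tail lx) (Linked.tail ly) (tail⊆ lx ly x≡y xs⊆ys)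
                                (tail⊆ ly lx (sym x≡y) ys⊆xs))
  where
  x≡y : x ≡ y
  x≡y = ≤-antisym (∈⇒≤head ly (xs⊆ys (here refl))) (∈⇒≤head lx (ys⊆xs (here refl)))
  tail⊆ : ∀ {u us v vs} → Linked _>_ (u ∷ us) → Linked _>_ (v ∷ vs) → u ≡ v →
          (∀ {z} → z ∈ u ∷ us → z ∈ v ∷ vs) → ∀ {z} → z ∈ us → z ∈ vs
  tail⊆ lu lv refl us⊆vs z∈us with us⊆vs (there z∈us)
  ... | here refl = ⊥-elim (<-irrefl refl (All.lookup (Linked>⇒All<head lu) z∈us))
  ... | there z∈vs = z∈vs

Any<-tail : x > y → Any (_< g) (x ∷ y ∷ ys) → Any (_< g) (y ∷ ys)
Any<-tail x>y (here x<g) = here (<-trans x>y x<g)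
Any<-tail _ (there below) = below

nonincreasing∧unique⇒decreasing : Linked _≥_ xs → Unique xs → Linked _>_ xs
nonincreasing∧unique⇒decreasing [] _ = []
nonincreasing∧unique⇒decreasing [-] _ = [-]
nonincreasing∧unique⇒decreasing (x≥y ∷ l) ((x≢y ∷ _) ∷ u) =
  ≤∧≢⇒< x≥y (x≢y ∘ sym) ∷ nonincreasing∧unique⇒decreasing l u

Unique-++⁻ˡ : ∀ xs → Unique (xs ++ ys) → Unique xs
Unique-++⁻ˡ [] _ = []
Unique-++⁻ˡ (x ∷ xs) (x∉ ∷ u) = ++⁻ˡ xs x∉ ∷ Unique-++⁻ˡ xs u

Unique-++⁻ʳ : ∀ xs → Unique (xs ++ ys) → Unique ys
Unique-++⁻ʳ [] u = u
Unique-++⁻ʳ (x ∷ xs) (_ ∷ u) = Unique-++⁻ʳ xs u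

Unique-++⇒disjoint : ∀ xs → Unique (xs ++ ys) → z ∈ xs → z ∉ ys
Unique-++⇒disjoint (x ∷ xs) (x∉ ∷ _) (here refl) z∈ys = All.lookup (++⁻ʳ xs x∉) z∈ys refl
Unique-++⇒disjoint (x ∷ xs) (_ ∷ u) (there z∈xs) = Unique-++⇒disjoint xs u z∈xs

InRange : ℕ → ℕ → Set
InRange n z = 1 ≤ z × z ≤ n

decreasingOneTo-decreasing : ∀ n → Linked _>_ (decreasingOneTo n)
decreasingOneTo-decreasing zero = []
decreasingOneTo-decreasing (suc zero) = [-]
decreasingOneTo-decreasing (suc (suc n)) = n<1+n (suc n) ∷ decreasingOneTo-decreasing (suc n)

∈-decreasingOneTo⁺ : InRange n z → z ∈ decreasingOneTo n
∈-decreasingOneTo⁺ (s≤s _ , i<n) = ∈-map⁺ suc (∈-downFrom⁺ i<n)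

∈-decreasingOneTo⁻ : z ∈ decreasingOneTo n → InRange n z
∈-decreasingOneTo⁻ z∈ with _ , x∈ , refl ← ∈-map⁻ suc z∈ = s≤s z≤n , ∈-downFrom⁻ x∈

decreasingOneTo↭oneTo : ∀ n → decreasingOneTo n ↭ oneTo n
decreasingOneTo↭oneTo n =
  map⁺ suc (↭-trans (↭-reflexive (sym (reverse-upTo n))) (↭-reverse (upTo n)))

permutation↭decreasingOneTo : IsPermutation n π → π ↭ decreasingOneTo n
permutation↭decreasingOneTo {n} π↭ = ↭-trans π↭ (↭-sym (decreasingOneTo↭oneTo n))

∈-permutation⁺ : IsPermutation n π → InRange n z → z ∈ π
∈-permutation⁺ π↭ z∈ = ∈-resp-↭ (↭-sym (permutation↭decreasingOneTo π↭)) (∈-decreasingOneTo⁺ z∈)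

∈-permutation⁻ : IsPermutation n π → z ∈ π → InRange n z
∈-permutation⁻ π↭ z∈ = ∈-decreasingOneTo⁻ (∈-resp-↭ (permutation↭decreasingOneTo π↭) z∈)

permutation-unique : IsPermutation n π → Unique π
permutation-unique {n} π↭ =
  PermutationₛProperties.Unique-resp-↭ (setoid ℕ) (↭⇒↭ₛ (↭-sym (permutation↭decreasingOneTo π↭)))
    (Unique.map⁺ suc-injective (downFrom⁺ n))

-- β, the decreasing complement of γ

complement : ℕ → List ℕ → List ℕ
complement n γ = filter (λ x → ¬? (x ∈? γ)) (decreasingOneTo n)

complement-decreasing : ∀ n γ → Linked _>_ (complement n γ)
complement-decreasing n γ =
  Linkedₚ.filter⁺ (λ x → ¬? (x ∈? γ)) (flip <-trans) (decreasingOneTo-decreasing n)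

∈-complement⁺ : InRange n z → z ∉ γ → z ∈ complement n γ
∈-complement⁺ {γ = γ} z∈ z∉γ = ∈-filter⁺ (λ x → ¬? (x ∈? γ)) (∈-decreasingOneTo⁺ z∈) z∉γ

∈-complement⁻ : z ∈ complement n γ → InRange n z × z ∉ γ
∈-complement⁻ {n = n} {γ = γ} z∈ with z∈D , z∉γ ← ∈-filter⁻ (λ x → ¬? (x ∈? γ)) {xs = decreasingOneTo n} z∈ =
  ∈-decreasingOneTo⁻ z∈D , z∉γ

complement-++↭oneTo : Linked _>_ γ → All (InRange n) γ → complement n γ ++ γ ↭ oneTo n
complement-++↭oneTo {γ} {n} γ↘ γ∈ = ↭-trans (↭-sym D↭β++γ) (decreasingOneTo↭oneTo n)
  where
  P? : ∀ x → Dec (x ∉ γ)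
  P? x = ¬? (x ∈? γ)
  Q? : ∀ x → Dec (¬ x ∉ γ)
  Q? x = ¬? (P? x)
  members : filter Q? (decreasingOneTo n) ≡ γ
  members = decreasing-ext (Linkedₚ.filter⁺ Q? (flip <-trans) (decreasingOneTo-decreasing n)) γ↘
    (λ z∈ → decidable-stable (_ ∈? γ) (proj₂ (∈-filter⁻ Q? {xs = decreasingOneTo n} z∈)))
    (λ z∈γ → ∈-filter⁺ Q? (∈-decreasingOneTo⁺ (All.lookup γ∈ z∈γ)) (λ z∉γ → z∉γ z∈γ))
  D↭β++γ : decreasingOneTo n ↭ complement n γ ++ γ
  D↭β++γ = subst (λ (p : List ℕ × List ℕ) → decreasingOneTo n ↭ proj₁ p ++ proj₂ p)
    (trans (partition-defn P? (decreasingOneTo n)) (cong (complement n γ ,_) members))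
    (↭ₛ⇒↭ (PermutationₛProperties.partition-↭ (setoid ℕ) P? (decreasingOneTo n)))

complement-unique : Linked _>_ β → IsPermutation n (β ++ γ) → complement n γ ≡ β
complement-unique {β} {n} {γ} β↘ π↭ = decreasing-ext (complement-decreasing n γ) β↘
  (λ z∈ → let z∈R , z∉γ = ∈-complement⁻ z∈ in
    case-∈β (∈-++⁻ β (∈-permutation⁺ π↭ z∈R)) z∉γ)
  (λ z∈β → ∈-complement⁺ (∈-permutation⁻ π↭ (∈-++⁺ˡ z∈β))
    (Unique-++⇒disjoint β (permutation-unique π↭) z∈β))
  where
  case-∈β : ∀ {z} → z ∈ β ⊎ z ∈ γ → z ∉ γ → z ∈ β
  case-∈β (inj₁ z∈β) _ = z∈β
  case-∈β (inj₂ z∈γ) z∉γ = ⊥-elim (z∉γ z∈γ)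

ascents-decreasing : Linked _>_ xs → ascents xs ≡ 0
ascents-decreasing [] = refl
ascents-decreasing [-] = refl
ascents-decreasing {x ∷ y ∷ _} (x>y ∷ l) with x <ᵇ y | <ᵇ-reflects-< x y
... | true | ofʸ x<y = ⊥-elim (<-asym x<y x>y)
... | false | ofⁿ _ = ascents-decreasing l

ascents≡0⇒nonincreasing : ∀ x xs → ascents (x ∷ xs) ≡ 0 → Linked _≥_ (x ∷ xs)
ascents≡0⇒nonincreasing x [] _ = [-]
ascents≡0⇒nonincreasing x (y ∷ xs) asc with x <ᵇ y | <ᵇ-reflects-< x y
... | false | ofⁿ x≮y = ≮⇒≥ x≮y ∷ ascents≡0⇒nonincreasing y xs asc

ascents-++ : Linked _>_ β → Linked _>_ (g ∷ gs) → Any (_< g) β → ascents (β ++ g ∷ gs) ≡ 1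
ascents-++ {x ∷ []} {g} _ γ↘ (here x<g) with x <ᵇ g | <ᵇ-reflects-< x g
... | true | ofʸ _ = cong suc (ascents-decreasing γ↘)
... | false | ofⁿ x≮g = ⊥-elim (x≮g x<g)
ascents-++ {x ∷ y ∷ _} {g} (x>y ∷ β↘) γ↘ below with x <ᵇ y | <ᵇ-reflects-< x y
... | true | ofʸ x<y = ⊥-elim (<-asym x<y x>y)
... | false | ofⁿ _ = ascents-++ β↘ γ↘ (Any<-tail x>y below)

record AscentSplit (π : List ℕ) : Set where
  constructor ascentSplit
  field
    {front} : List ℕ
    {peak} : ℕ
    {back} : List ℕ
    split : π ≡ front ++ peak ∷ back
    front↘ : Linked _≥_ front
    back↘ : Linked _≥_ (peak ∷ back)
    ascent : Any (_< peak) front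

ascents≡1⇒split : ∀ x xs → ascents (x ∷ xs) ≡ 1 → AscentSplit (x ∷ xs)
ascents≡1⇒split x (y ∷ xs) asc with x <ᵇ y | <ᵇ-reflects-< x y
... | true | ofʸ x<y = ascentSplit refl [-] (ascents≡0⇒nonincreasing y xs (suc-injective asc)) (here x<y)
... | false | ofⁿ x≮y with ascents≡1⇒split y xs asc
...   | ascentSplit {[]} _ _ _ ()
...   | ascentSplit {_ ∷ _} refl front↘ back↘ ascent =
          ascentSplit refl (≮⇒≥ x≮y ∷ front↘) back↘ (there ascent)

afterAscent : List ℕ → List ℕ
afterAscent [] = []
afterAscent (x ∷ []) = []
afterAscent (x ∷ y ∷ xs) = if x <ᵇ y then y ∷ xs else afterAscent (y ∷ xs)

afterAscent-++ : Linked _>_ β → Any (_< g) β → afterAscent (β ++ g ∷ gs) ≡ g ∷ gs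
afterAscent-++ {x ∷ []} {g} _ (here x<g) with x <ᵇ g | <ᵇ-reflects-< x g
... | true | ofʸ _ = refl
... | false | ofⁿ x≮g = ⊥-elim (x≮g x<g)
afterAscent-++ {x ∷ y ∷ _} {g} (x>y ∷ β↘) below with x <ᵇ y | <ᵇ-reflects-< x y
... | true | ofʸ x<y = ⊥-elim (<-asym x<y x>y)
... | false | ofⁿ _ = afterAscent-++ β↘ (Any<-tail x>y below)

-- Missing values below the head of a decreasing list

length≤head : Linked _>_ (g ∷ gs) → All (1 ≤_) (g ∷ gs) → length (g ∷ gs) ≤ g
length≤head {gs = []} _ (1≤g ∷ _) = 1≤g
length≤head {gs = _ ∷ _} (g>g₂ ∷ γ↘) (_ ∷ pos) = ≤-trans (s≤s (length≤head γ↘ pos)) g>g₂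

length<head⇒missing : Linked _>_ (g ∷ gs) → All (1 ≤_) (g ∷ gs) → length (g ∷ gs) < g →
                      Σ ℕ λ x → 1 ≤ x × x < g × x ∉ g ∷ gs
length<head⇒missing {g} {[]} _ _ 1<g = 1 , ≤-refl , 1<g , λ { (here 1≡g) → <-irrefl 1≡g 1<g }
length<head⇒missing {suc g′} {g₂ ∷ gs} (g>g₂ ∷ γ↘) (_ ∷ pos) len<g with length (g₂ ∷ gs) <? g₂
... | yes len<g₂ with x , 1≤x , x<g₂ , x∉ ← length<head⇒missing γ↘ pos len<g₂ =
  x , 1≤x , <-trans x<g₂ g>g₂ ,
  λ { (here x≡g) → <-irrefl x≡g (<-trans x<g₂ g>g₂) ; (there x∈) → x∉ x∈ }
... | no len≮g₂ = g′ , ≤-trans (s≤s z≤n) g₂<g′ , n<1+n g′ ,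
  λ { (here g′≡g) → <-irrefl g′≡g (n<1+n g′) ; (there g′∈) → <⇒≱ g₂<g′ (∈⇒≤head γ↘ g′∈) }
  where
  g₂<g′ : g₂ < g′
  g₂<g′ = ≤-<-trans (≮⇒≥ len≮g₂) (≤-pred len<g)

missing⇒length<head : Linked _>_ (g ∷ gs) → All (1 ≤_) (g ∷ gs) →
                      1 ≤ x → x < g → x ∉ g ∷ gs → length (g ∷ gs) < g
missing⇒length<head {gs = []} _ _ 1≤x x<g _ = ≤-<-trans 1≤x x<g
missing⇒length<head {gs = g₂ ∷ gs} {x} (g>g₂ ∷ γ↘) (_ ∷ pos) 1≤x x<g x∉ with x <? g₂
... | yes x<g₂ = ≤-<-trans (missing⇒length<head γ↘ pos 1≤x x<g₂ (x∉ ∘ there)) g>g₂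
... | no x≮g₂ = ≤-<-trans (≤-trans (s≤s (length≤head γ↘ pos)) g₂<x) x<g
  where
  g₂<x : g₂ < x
  g₂<x = ≤∧≢⇒< (≮⇒≥ x≮g₂) (λ g₂≡x → x∉ (there (here (sym g₂≡x))))

shiftDown : ℕ → List ℕ → List ℕ
shiftDown k [] = []
shiftDown k (x ∷ xs) = x ∸ k ∷ shiftDown (suc k) xs

shiftUp : ℕ → List ℕ → List ℕ
shiftUp k [] = []
shiftUp k (x ∷ xs) = k + x ∷ shiftUp (suc k) xs

NoSpecialPartFrom : ℕ → List ℕ → Set
NoSpecialPartFrom k [] = ⊤
NoSpecialPartFrom k (x ∷ xs) = k < x × NoSpecialPartFrom (suc k) xs

applyUpTo-cong : ∀ {f h : ℕ → ℕ} → (∀ i → f i ≡ h i) → ∀ n → applyUpTo f n ≡ applyUpTo h n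
applyUpTo-cong f≗h zero = refl
applyUpTo-cong f≗h (suc n) = cong₂ _∷_ (f≗h 0) (applyUpTo-cong (f≗h ∘ suc) n)

zipWith-∸-applyUpTo : ∀ k xs → zipWith _∸_ xs (applyUpTo (k +_) (length xs)) ≡ shiftDown k xs
zipWith-∸-applyUpTo k [] = refl
zipWith-∸-applyUpTo k (x ∷ xs) = cong₂ _∷_ (cong (x ∸_) (+-identityʳ k)) (begin
  zipWith _∸_ xs (applyUpTo (λ i → k + suc i) (length xs))  ≡⟨ cong (zipWith _∸_ xs) (applyUpTo-cong (+-suc k) (length xs)) ⟩
  zipWith _∸_ xs (applyUpTo (suc k +_) (length xs))         ≡⟨ zipWith-∸-applyUpTo (suc k) xs ⟩
  shiftDown (suc k) xs                                      ∎)
  where open ≡-Reasoning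

gamma≡shiftDown : ∀ a → gamma a ≡ shiftDown 0 a
gamma≡shiftDown = zipWith-∸-applyUpTo 0

length-shiftDown : ∀ k xs → length (shiftDown k xs) ≡ length xs
length-shiftDown k [] = refl
length-shiftDown k (x ∷ xs) = cong suc (length-shiftDown (suc k) xs)

length-shiftUp : ∀ k xs → length (shiftUp k xs) ≡ length xs
length-shiftUp k [] = refl
length-shiftUp k (x ∷ xs) = cong suc (length-shiftUp (suc k) xs)

shiftUp-shiftDown : ∀ k xs → NoSpecialPartFrom k xs → shiftUp k (shiftDown k xs) ≡ xs
shiftUp-shiftDown k [] _ = refl
shiftUp-shiftDown k (x ∷ xs) (k<x , nsp) = cong₂ _∷_ (m+[n∸m]≡n (<⇒≤ k<x)) (shiftUp-shiftDown (suc k) xs nsp)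

shiftDown-shiftUp : ∀ k xs → shiftDown k (shiftUp k xs) ≡ xs
shiftDown-shiftUp k [] = refl
shiftDown-shiftUp k (x ∷ xs) = cong₂ _∷_ (m+n∸m≡n k x) (shiftDown-shiftUp (suc k) xs)

shiftDown-decreasing : Linked _≥_ xs → NoSpecialPartFrom k xs → Linked _>_ (shiftDown k xs)
shiftDown-decreasing [] _ = []
shiftDown-decreasing [-] _ = [-]
shiftDown-decreasing {k = k} (x≥y ∷ l) (_ , nsp@(1+k<y , _)) =
  <-≤-trans (∸-monoʳ-< (n<1+n k) (<⇒≤ 1+k<y)) (∸-monoˡ-≤ k x≥y) ∷ shiftDown-decreasing l nsp

shiftDown-positive : ∀ k xs → NoSpecialPartFrom k xs → All (1 ≤_) (shiftDown k xs)
shiftDown-positive k [] _ = []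
shiftDown-positive k (x ∷ xs) (k<x , nsp) = m<n⇒0<n∸m k<x ∷ shiftDown-positive (suc k) xs nsp

shiftUp-nonincreasing : Linked _>_ xs → Linked _≥_ (shiftUp k xs)
shiftUp-nonincreasing [] = []
shiftUp-nonincreasing [-] = [-]
shiftUp-nonincreasing {k = k} (x>y ∷ l) = +-monoʳ-< k x>y ∷ shiftUp-nonincreasing l

shiftUp-noSpecialPartFrom : ∀ k xs → All (1 ≤_) xs → NoSpecialPartFrom k (shiftUp k xs)
shiftUp-noSpecialPartFrom k [] _ = tt
shiftUp-noSpecialPartFrom k (x ∷ xs) (1≤x ∷ pos) = m<m+n k 1≤x , shiftUp-noSpecialPartFrom (suc k) xs pos

noSpecialPartFrom-positive : ∀ k xs → NoSpecialPartFrom k xs → All (1 ≤_) xs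
noSpecialPartFrom-positive k [] _ = []
noSpecialPartFrom-positive k (x ∷ xs) (k<x , nsp) = ≤-trans (s≤s z≤n) k<x ∷ noSpecialPartFrom-positive (suc k) xs nsp

noSpecialPartFrom⁺ : ∀ k xs → ((i : Fin (length xs)) → k + toℕ i < lookup xs i) → NoSpecialPartFrom k xs
noSpecialPartFrom⁺ k [] _ = tt
noSpecialPartFrom⁺ k (x ∷ xs) above =
  subst (_< x) (+-identityʳ k) (above fzero) ,
  noSpecialPartFrom⁺ (suc k) xs (λ i → subst (_< lookup xs i) (+-suc k (toℕ i)) (above (fsuc i)))

noSpecialPartFrom⁻ : ∀ k xs → NoSpecialPartFrom k xs → (i : Fin (length xs)) → k + toℕ i < lookup xs i
noSpecialPartFrom⁻ k (x ∷ xs) (k<x , _) fzero = subst (_< x) (sym (+-identityʳ k)) k<x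
noSpecialPartFrom⁻ k (x ∷ xs) (_ , nsp) (fsuc i) =
  subst (_< lookup xs i) (sym (+-suc k (toℕ i))) (noSpecialPartFrom⁻ (suc k) xs nsp i)

-- The sequences γ that arise from some a

data GammaWord (n : ℕ) : List ℕ → Set where
  gammaWord : Linked _>_ (g ∷ gs) → All (InRange n) (g ∷ gs) → length (g ∷ gs) < g →
              GammaWord n (g ∷ gs)

gamma-gammaWord : ∀ {a} → OneRowDPPNoSpecial n a → GammaWord n (gamma a)
gamma-gammaWord {n} {a₁ ∷ as} (dpp _ a₁≤n a↘ len<a₁ , noSpecial) =
  subst (GammaWord n) (sym (gamma≡shiftDown (a₁ ∷ as)))
    (gammaWord γ↘ (All.tabulate inRange) (subst (_< a₁) (sym (length-shiftDown 0 (a₁ ∷ as))) len<a₁))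
  where
  nsp : NoSpecialPartFrom 0 (a₁ ∷ as)
  nsp = noSpecialPartFrom⁺ 0 (a₁ ∷ as) noSpecial
  γ↘ : Linked _>_ (shiftDown 0 (a₁ ∷ as))
  γ↘ = shiftDown-decreasing a↘ nsp
  inRange : ∀ {z} → z ∈ shiftDown 0 (a₁ ∷ as) → InRange n z
  inRange z∈ = All.lookup (shiftDown-positive 0 (a₁ ∷ as) nsp) z∈ , ≤-trans (∈⇒≤head γ↘ z∈) a₁≤n

gamma-injective : ∀ {a b} → OneRowDPPNoSpecial n a → OneRowDPPNoSpecial n b → gamma a ≡ gamma b → a ≡ b
gamma-injective {a = a} {b} (_ , noSpecialᵃ) (_ , noSpecialᵇ) γᵃ≡γᵇ = begin
  a                          ≡⟨ shiftUp-shiftDown 0 a (noSpecialPartFrom⁺ 0 a noSpecialᵃ) ⟨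
  shiftUp 0 (shiftDown 0 a)  ≡⟨ cong (shiftUp 0) (gamma≡shiftDown a) ⟨
  shiftUp 0 (gamma a)        ≡⟨ cong (shiftUp 0) γᵃ≡γᵇ ⟩
  shiftUp 0 (gamma b)        ≡⟨ cong (shiftUp 0) (gamma≡shiftDown b) ⟩
  shiftUp 0 (shiftDown 0 b)  ≡⟨ shiftUp-shiftDown 0 b (noSpecialPartFrom⁺ 0 b noSpecialᵇ) ⟩
  b                          ∎
  where open ≡-Reasoning

gamma-surjective : GammaWord n γ → Σ (List ℕ) λ a → OneRowDPPNoSpecial n a × gamma a ≡ γ
gamma-surjective {n} {g ∷ gs} (gammaWord γ↘ inRange len<g) =
  a , (dpp (noSpecialPartFrom-positive 0 a nsp) (proj₂ (All.head inRange)) (shiftUp-nonincreasing γ↘)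
           (subst (_< g) (sym (length-shiftUp 0 (g ∷ gs))) len<g) ,
       noSpecialPartFrom⁻ 0 a nsp) ,
  trans (gamma≡shiftDown a) (shiftDown-shiftUp 0 (g ∷ gs))
  where
  a : List ℕ
  a = shiftUp 0 (g ∷ gs)
  nsp : NoSpecialPartFrom 0 a
  nsp = shiftUp-noSpecialPartFrom 0 (g ∷ gs) (All.map proj₁ inRange)

-- The permutations βγ

word : ℕ → List ℕ → List ℕ
word n γ = complement n γ ++ γ

complement-has-ascent : GammaWord n (g ∷ gs) → Any (_< g) (complement n (g ∷ gs))
complement-has-ascent (gammaWord γ↘ inRange len<g)
  with x , 1≤x , x<g , x∉ ← length<head⇒missing γ↘ (All.map proj₁ inRange) len<g =
  lose (∈-complement⁺ (1≤x , ≤-trans (<⇒≤ x<g) (proj₂ (All.head inRange))) x∉) x<g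

word-oneAscent : GammaWord n γ → PermOneAscent n (word n γ)
word-oneAscent {n} w@(gammaWord γ↘ inRange _) =
  complement-++↭oneTo γ↘ inRange , ascents-++ (complement-decreasing n _) γ↘ (complement-has-ascent w)

afterAscent-word : GammaWord n γ → afterAscent (word n γ) ≡ γ
afterAscent-word {n} w@(gammaWord _ _ _) = afterAscent-++ (complement-decreasing n _) (complement-has-ascent w)

word-injective : GammaWord n γ → GammaWord n δ → word n γ ≡ word n δ → γ ≡ δ
word-injective wγ wδ e = trans (sym (afterAscent-word wγ)) (trans (cong afterAscent e) (afterAscent-word wδ))

word-surjective : PermOneAscent n π → Σ (List ℕ) λ γ → GammaWord n γ × word n γ ≡ π
word-surjective {n} {x ∷ xs} (π↭ , asc) with ascents≡1⇒split x xs asc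
... | ascentSplit {[]} _ _ _ ()
... | ascentSplit {β@(_ ∷ _)} {g} {gs} refl β↘ γ↘ ascent with y , y∈β , y<g ← find ascent =
  g ∷ gs , gammaWord γ↘′ inRange len<g , cong (_++ g ∷ gs) (complement-unique β↘′ π↭)
  where
  u : Unique (β ++ g ∷ gs)
  u = permutation-unique π↭
  β↘′ : Linked _>_ β
  β↘′ = nonincreasing∧unique⇒decreasing β↘ (Unique-++⁻ˡ β u)
  γ↘′ : Linked _>_ (g ∷ gs)
  γ↘′ = nonincreasing∧unique⇒decreasing γ↘ (Unique-++⁻ʳ β u)
  inRange : All (InRange n) (g ∷ gs)
  inRange = All.tabulate (∈-permutation⁻ π↭ ∘ ∈-++⁺ʳ β)
  len<g : length (g ∷ gs) < g
  len<g = missing⇒length<head γ↘′ (All.map proj₁ inRange) (proj₁ (∈-permutation⁻ π↭ (∈-++⁺ˡ y∈β)))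
            y<g (Unique-++⇒disjoint β u y∈β)

lemma3p1 : (n : ℕ) → 1 ≤ n →
    ((a : List ℕ) → OneRowDPPNoSpecial n a → PermOneAscent n (dppToPerm n a))
    × ((a b : List ℕ) → OneRowDPPNoSpecial n a → OneRowDPPNoSpecial n b →
         dppToPerm n a ≡ dppToPerm n b → a ≡ b)
    × ((π : List ℕ) → PermOneAscent n π →
         Σ (List ℕ) (λ a → OneRowDPPNoSpecial n a × dppToPerm n a ≡ π))
lemma3p1 n _ = into , injective , onto
  where
  into : (a : List ℕ) → OneRowDPPNoSpecial n a → PermOneAscent n (dppToPerm n a)
  into a h = word-oneAscent (gamma-gammaWord h)
  injective : (a b : List ℕ) → OneRowDPPNoSpecial n a → OneRowDPPNoSpecial n b →
              dppToPerm n a ≡ dppToPerm n b → a ≡ b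
  injective a b ha hb e = gamma-injective ha hb (word-injective (gamma-gammaWord ha) (gamma-gammaWord hb) e)
  onto : (π : List ℕ) → PermOneAscent n π → Σ (List ℕ) (λ a → OneRowDPPNoSpecial n a × dppToPerm n a ≡ π)
  onto π h with γ , w , refl ← word-surjective h with a , ha , refl ← gamma-surjective w = a , ha , refl
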